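{- In the setting of the context, let $\hat g\in\mathrm{Aut}(\hat{\cal F}_\epsilon)$ with $\pi(\hat g)=g$. Then for every line $D$ of ${\cal F}$, $$\delta^\ast(g,D)=\prod_{P\in D}\delta(\hat g,P).$$ In other words $\delta^\ast(g,\cdot)$ is the multiplicative Radon transform of $\delta(\hat g,\cdot)$.
   Context: $\mathbb F$ is a field of characteristic not $2$. ${\cal F}$ is a Fano plane with an automorphism $\tau$ of order $7$ such that with $P_i=\tau^i(P_0)$ ($i\in\mathbb Z_7$) the lines are exactly $D_i=\{P_i,P_{i+1},P_{i+3}\}$. $\epsilon$ is the canonical composition factor: $\epsilon_{P_iP_j}=1$ if $j-i\equiv1,2,4\pmod7$, $-1$ if $j-i\equiv3,5,6\pmod7$. $\mathbb O_{\cal F}$ has basis $1,e_P$, unit $1$, $e_Pe_Q=\epsilon_{PQ}e_{P+Q}$ ($P\ne Q$, $P+Q$ the third point on their line), $e_P^2=-1$. $L_x$ is left multiplication, $e_{P,Q}=\tfrac14(L_{e_P}L_{e_Q}-L_{e_Q}L_{e_P})$, and $X_{P_i,D_i}=e_{P_{i+2},P_{i-1}}-e_{P_{i-3},P_{i-2}}$, $X_{P_i,D_{i-1}}=e_{P_{i-3},P_{i-2}}-e_{P_{i+1},P_{i+3}}$, $X_{P_i,D_{i-3}}=e_{P_{i+1},P_{i+3}}-e_{P_{i+2},P_{i-1}}$ (these are defined for all incident pairs, since the lines through $P_i$ are $D_i,D_{i-1},D_{i-3}$). $\hat{\cal F}_\epsilon=\{\pm e_P\}$; $\mathrm{Aut}(\hat{\cal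 F}_\epsilon)$ is the group of maps $\hat h$ of $\hat{\cal F}_\epsilon$ with $\hat h(-e_P)=-\hat h(e_P)$ and $\hat h(e_Pe_Q)=\hat h(e_P)\hat h(e_Q)$ ($P\ne Q$); each $\hat h$ is extended to a linear automorphism of $\mathbb O_{\cal F}$ with $\hat h(1)=1$; $\pi(\hat h)\in\mathrm{Aut}({\cal F})$ is the induced permutation of points. For an incident pair $(P,D)$ one has $\hat g X_{P,D}\hat g^{ -1}=\pm X_{\pi(\hat g)(P),\pi(\hat g)(D)}$, and the sign, denoted $\delta(\hat g,P)\in\{\pm1\}$, does not depend on the line $D\ni P$. For $g\in\mathrm{Aut}({\cal F})$ and a line $D$, $\delta^\ast(g,D)=\epsilon_{PQ}\epsilon_{g(P)g(Q)}$ for any distinct $P,Q\in D$ (independent of the choice). -}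

module Defs where

open import Level using (Level; _⊔_) renaming (suc to lsuc)
open import Algebra.Bundles using (CommutativeRing)
open import Data.Nat as ℕ using (ℕ; zero; suc)
open import Data.Nat.DivMod using (_%_; m%n<n)
open import Data.Fin as Fin using (Fin; toℕ; fromℕ<; _≟_)
open import Data.Bool using (Bool; true; false; if_then_else_; _∨_; _∧_; not)
open import Data.Maybe using (Maybe; just; nothing; fromMaybe)
import Data.Maybe as Maybe
open import Data.Sign using (Sign; opposite) renaming (_*_ to _*ₛ_; + to pos; - to neg)
open import Data.Product using (_×_; _,_; proj₁; proj₂; ∃)
open import Relation.Nullary using (¬_; does)
open import Relation.Binary.PropositionalEquality using (_≡_)

record Field (c ℓ : Level) : Set (lsuc (c ⊔ ℓ)) where
  field
    commutativeRing : CommutativeRing c ℓ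
  open CommutativeRing commutativeRing public
  field
    0≉1 : ¬ (0# ≈ 1#)
    inverse : ∀ x → ¬ (x ≈ 0#) → ∃ λ y → x * y ≈ 1#

CharNot2 : ∀ {c ℓ} → Field c ℓ → Set ℓ
CharNot2 F = ¬ ((1# + 1#) ≈ 0#) where open Field F

-- The Fano plane: points P_i and lines D_i, i ∈ ℤ₇ (both as Fin 7);
-- τ is i ↦ i+1, P_i = τ^i(P_0); D_i = {P_i, P_{i+1}, P_{i+3}}.

Point : Set
Point = Fin 7

Line : Set
Line = Fin 7

_⊕_ : Fin 7 → ℕ → Fin 7
i ⊕ k = fromℕ< (m%n<n (toℕ i ℕ.+ k) 7)

pt : Line → Fin 3 → Point
pt j Fin.zero = j
pt j (Fin.suc Fin.zero) = j ⊕ 1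
pt j (Fin.suc (Fin.suc Fin.zero)) = j ⊕ 3

_==_ : ∀ {n} → Fin n → Fin n → Bool
i == j = does (i ≟ j)

inc : Point → Line → Bool
inc P j = (P == pt j Fin.zero) ∨ (P == pt j (Fin.suc Fin.zero))
          ∨ (P == pt j (Fin.suc (Fin.suc Fin.zero)))

Incident : Point → Line → Set
Incident P D = inc P D ≡ true

search : ∀ n → (Fin n → Bool) → Maybe (Fin n)
search zero p = nothing
search (suc n) p = if p Fin.zero then just Fin.zero
                   else Maybe.map Fin.suc (search n (λ i → p (Fin.suc i)))

lineOf : Point → Point → Line
lineOf P Q = fromMaybe Fin.zero (search 7 (λ j → inc P j ∧ inc Q j))

third : Point → Point → Point
third P Q = fromMaybe P (search 7 (λ R → not (R == P) ∧ not (R == Q)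
                                         ∧ inc R (lineOf P Q)))

εsgn : ℕ → Sign
εsgn 1 = pos
εsgn 2 = pos
εsgn 4 = pos
εsgn _ = neg

ε : Point → Point → Sign
ε Pi Pj = εsgn ((toℕ Pj ℕ.+ 7 ℕ.∸ toℕ Pi) % 7)

imgLine : (Point → Point) → Line → Line
imgLine g D = lineOf (g (pt D Fin.zero)) (g (pt D (Fin.suc Fin.zero)))

δ* : (Point → Point) → Line → Sign
δ* g D = ε P Q *ₛ ε (g P) (g Q)
  where P = pt D Fin.zero
        Q = pt D (Fin.suc Fin.zero)

prodOn : (Point → Sign) → Line → Sign
prodOn s D = s (pt D Fin.zero) *ₛ s (pt D (Fin.suc Fin.zero))
             *ₛ s (pt D (Fin.suc (Fin.suc Fin.zero)))

-- The signed basis  F̂_ε = {± e_P} as Sign × Point, (s , P) ↦ s e_P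

SU : Set
SU = Sign × Point

negSU : SU → SU
negSU (s , P) = (opposite s , P)

-- the element e_P e_Q = ε_{PQ} e_{P+Q} of F̂_ε (P ≠ Q)
mulSU : Point → Point → SU
mulSU P Q = (ε P Q , third P Q)

π : (SU → SU) → Point → Point
π h P = proj₂ (h (pos , P))

-- The octonion algebra O_F over a field of characteristic ≠ 2.
-- Basis index: Fin 8, with zero ↦ 1 and suc P ↦ e_P.

module Octonions {c ℓ} (F : Field c ℓ) (ch : CharNot2 F) where
  open Field F

  V : Set c
  V = Fin 8 → Carrier

  _≈V_ : V → V → Set ℓ
  u ≈V v = ∀ k → u k ≈ v k

  Op : Set c
  Op = V → V

  sgn : Sign → Carrier → Carrier
  sgn pos x = x
  sgn neg x = - x

  Σ' : ∀ {n} → (Fin n → Carrier) → Carrier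
  Σ' {zero} f = 0#
  Σ' {suc n} f = f Fin.zero + Σ' (λ i → f (Fin.suc i))

  basis : Fin 8 → V
  basis k j = if j == k then 1# else 0#

  mulBasis : Fin 8 → Fin 8 → Sign × Fin 8
  mulBasis Fin.zero b = (pos , b)
  mulBasis (Fin.suc P) Fin.zero = (pos , Fin.suc P)
  mulBasis (Fin.suc P) (Fin.suc Q) =
    if P == Q then (neg , Fin.zero) else (ε P Q , Fin.suc (third P Q))

  _·_ : V → V → V
  (u · v) k = Σ' λ a → Σ' λ b →
    if proj₂ (mulBasis a b) == k then sgn (proj₁ (mulBasis a b)) (u a * v b)
    else 0#

  ι : SU → V
  ι (s , P) k = sgn s (basis (Fin.suc P) k)

  L : V → Op
  L x v = x · v

  _∘ₒ_ : Op → Op → Op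
  (A ∘ₒ B) v = A (B v)

  _-ₒ_ : Op → Op → Op
  (A -ₒ B) v k = A v k - B v k

  _⋆ₒ_ : Carrier → Op → Op
  (a ⋆ₒ A) v k = a * A v k

  zeroOp : Op
  zeroOp v k = 0#

  eP : Point → V
  eP P = basis (Fin.suc P)

  half : Carrier
  half = proj₁ (inverse (1# + 1#) ch)

  quarter : Carrier
  quarter = half * half

  eOp : Point → Point → Op
  eOp P Q = quarter ⋆ₒ ((L (eP P) ∘ₒ L (eP Q)) -ₒ (L (eP Q) ∘ₒ L (eP P)))

  -- X_{P_i, D} for the three lines D_i, D_{i-1}, D_{i-3} through P_i
  -- (i-1 = i⊕6, i-2 = i⊕5, i-3 = i⊕4); zero for non-incident pairs
  X : Point → Line → Op
  X i D =
    if D == i then eOp (i ⊕ 2) (i ⊕ 6) -ₒ eOp (i ⊕ 4) (i ⊕ 5)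
    else if D == (i ⊕ 6) then eOp (i ⊕ 4) (i ⊕ 5) -ₒ eOp (i ⊕ 1) (i ⊕ 3)
    else if D == (i ⊕ 4) then eOp (i ⊕ 1) (i ⊕ 3) -ₒ eOp (i ⊕ 2) (i ⊕ 6)
    else zeroOp

  ext : (SU → SU) → Op
  ext h v k = (if k == Fin.zero then v Fin.zero else 0#)
              + Σ' (λ P → v (Fin.suc P) * ι (h (pos , P)) k)

  record IsAut (h hinv : SU → SU) : Set (c ⊔ ℓ) where
    field
      left-inv  : ∀ x → hinv (h x) ≡ x
      right-inv : ∀ x → h (hinv x) ≡ x
      odd       : ∀ x → h (negSU x) ≡ negSU (h x)
      mult      : ∀ P Q → ¬ (P ≡ Q) →
                  ι (h (mulSU P Q)) ≈V (ι (h (pos , P)) · ι (h (pos , Q)))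

  IsDelta : (h hinv : SU → SU) → (Point → Sign) → Set (c ⊔ ℓ)
  IsDelta h hinv s = ∀ P D → Incident P D → ∀ v →
    ext h (X P D (ext hinv v))
      ≈V (λ k → sgn (s P) (X (π h P) (imgLine (π h) D) v k))

-- Write ĥ(e_P) = σ(P) e_{g(P)}.  Multiplicativity of ĥ gives g(P+Q) = g(P)+g(Q) and
-- σ(P) σ(Q) σ(P+Q) = ε_{PQ} ε_{g(P)g(Q)}, so the product of σ over a line D is δ*(g,D).
-- For P on D and A off D the operator X_{P,D} maps e_A to ± e_{P+A}; write X_{P,D} e_A = f(P,D,A) e_{P+A}.
-- Evaluating ĥ X_{P,D} ĥ⁻¹ = δ(P) X_{gP,gD} on ĥ e_A gives δ(P) = σ(P) w(P,D,A) w(gP,gD,gA) with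
-- w(P,D,A) = f(P,D,A) ε_{A,P+A}.  A finite computation shows that the product of w(·,D,A) over the
-- points of D is 1 for every line D and point A off D; applied to D and to g(D) (with gA off gD) it
-- leaves ∏_{P∈D} δ(P) = ∏_{P∈D} σ(P) = δ*(g,D).

module Submission where

open import Defs
open import Level using (Level)
open import Data.Sign using (Sign)
open import Relation.Binary.PropositionalEquality using (_≡_)

open import Data.Bool using (true; false; T; _∨_; if_then_else_)
import Data.Bool.Properties as Bool
open import Data.Empty using (⊥-elim)
import Data.Nat as ℕ
open import Data.Fin using (Fin; zero; suc)
open import Data.Fin.Properties using (all?; any?; suc-injective) renaming (_≟_ to _≟ᶠ_)
open import Data.Product using (_×_; _,_; proj₁; proj₂; ∃)
open import Data.Product.Properties using (≡-dec)
open import Data.Sign using (opposite) renaming (_*_ to _*ₛ_; + to pos; - to neg)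
import Data.Sign.Properties as Sign
open import Data.Sum using (_⊎_; inj₁; inj₂)
open import Data.Unit using (tt)
open import Function using (_∘_)
open import Relation.Binary.PropositionalEquality
  using (_≢_; refl; sym; trans; cong; cong₂; subst; subst₂; module ≡-Reasoning)
open import Relation.Nullary using (Dec; yes; no; ¬_; ¬?)
open import Relation.Nullary.Decidable
  using (toWitness; dec-true; dec-false; _→-dec_; _×-dec_; _⊎-dec_)
open import Algebra.Properties.Group Sign.*-group using (quasigroup; //-rightDividesʳ)
open import Algebra.Properties.Quasigroup quasigroup using (y≈x\\z; x≈z//y)
open import Algebra.Properties.CommutativeSemigroup Sign.*-commutativeSemigroup using (interchange)
open import Algebra.Solver.CommutativeMonoid Sign.*-commutativeMonoid using (solve; _⊜_) renaming (_⊕_ to _⊗_)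

*ₛ-transpose : ∀ {a b w z} → a *ₛ z ≡ b *ₛ w → w *ₛ z ≡ a *ₛ b
*ₛ-transpose {a} {b} {w} {z} eq = begin
  w *ₛ z                ≡⟨ cong (w *ₛ_) (y≈x\\z a z _ eq) ⟩
  w *ₛ (a *ₛ (b *ₛ w))  ≡⟨ solve 3 (λ a b w → w ⊗ (a ⊗ (b ⊗ w)) ⊜ (a ⊗ b) ⊗ (w ⊗ w)) refl a b w ⟩
  a *ₛ b *ₛ (w *ₛ w)    ≡⟨ cong (a *ₛ b *ₛ_) (Sign.s*s≡+ w) ⟩
  a *ₛ b *ₛ pos         ≡⟨ Sign.*-identityʳ (a *ₛ b) ⟩
  a *ₛ b                ∎
  where open ≡-Reasoning

solve-for-δ : ∀ f f′ σA σB σP εA εg δ →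
              f *ₛ σB ≡ δ *ₛ (σA *ₛ f′) → σA *ₛ σB *ₛ σP ≡ εA *ₛ εg →
              δ ≡ σP *ₛ ((f *ₛ εA) *ₛ (f′ *ₛ εg))
solve-for-δ f f′ σA σB σP εA εg δ conj line = begin
  δ                               ≡⟨ x≈z//y δ _ _ (sym conj) ⟩
  f *ₛ σB *ₛ (σA *ₛ f′)           ≡⟨ solve 4 (λ f f′ a b → (f ⊗ b) ⊗ (a ⊗ f′) ⊜ (f ⊗ f′) ⊗ (a ⊗ b)) refl f f′ σA σB ⟩
  f *ₛ f′ *ₛ (σA *ₛ σB)           ≡⟨ cong (f *ₛ f′ *ₛ_) (x≈z//y (σA *ₛ σB) σP _ line) ⟩
  f *ₛ f′ *ₛ (εA *ₛ εg *ₛ σP)     ≡⟨ solve 5 (λ f f′ e e′ p → (f ⊗ f′) ⊗ ((e ⊗ e′) ⊗ p) ⊜ p ⊗ ((f ⊗ e) ⊗ (f′ ⊗ e′))) refl f f′ εA εg σP ⟩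
  σP *ₛ ((f *ₛ εA) *ₛ (f′ *ₛ εg)) ∎
  where open ≡-Reasoning

prodOn-cong : ∀ {s t : Point → Sign} D → (∀ i → s (pt D i) ≡ t (pt D i)) → prodOn s D ≡ prodOn t D
prodOn-cong D eq = cong₂ _*ₛ_ (cong₂ _*ₛ_ (eq zero) (eq (suc zero))) (eq (suc (suc zero)))

prodOn-* : ∀ (s t : Point → Sign) D → prodOn (λ P → s P *ₛ t P) D ≡ prodOn s D *ₛ prodOn t D
prodOn-* s t D = trans (cong (_*ₛ (s P₂ *ₛ t P₂)) (interchange (s P₀) (t P₀) (s P₁) (t P₁)))
                       (interchange (s P₀ *ₛ s P₁) (t P₀ *ₛ t P₁) (s P₂) (t P₂))
  where P₀ = pt D zero
        P₁ = pt D (suc zero)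
        P₂ = pt D (suc (suc zero))

-- The Fano plane

incident? : ∀ P D → Dec (Incident P D)
incident? P D = inc P D Bool.≟ true

pt-incident : ∀ D i → Incident (pt D i) D
pt-incident = toWitness {a? = all? λ D → all? λ i → incident? (pt D i) D} tt

incident⇒pt : ∀ P D → Incident P D → ∃ λ i → P ≡ pt D i
incident⇒pt = toWitness {a? = all? λ P → all? λ D → incident? P D →-dec any? λ i → P ≟ᶠ pt D i} tt

pt-distinct : ∀ D → pt D zero ≢ pt D (suc zero)
pt-distinct = toWitness {a? = all? λ D → ¬? (pt D zero ≟ᶠ pt D (suc zero))} tt

pt-third : ∀ D → third (pt D zero) (pt D (suc zero)) ≡ pt D (suc (suc zero))
pt-third = toWitness {a? = all? λ D → third (pt D zero) (pt D (suc zero)) ≟ᶠ pt D (suc (suc zero))} tt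

pt-lineOf : ∀ D → lineOf (pt D zero) (pt D (suc zero)) ≡ D
pt-lineOf = toWitness {a? = all? λ D → lineOf (pt D zero) (pt D (suc zero)) ≟ᶠ D} tt

lineOf-incident : ∀ P Q R → P ≢ Q → R ≡ P ⊎ R ≡ Q ⊎ R ≡ third P Q → Incident R (lineOf P Q)
lineOf-incident = toWitness {a? = all? λ P → all? λ Q → all? λ R → ¬? (P ≟ᶠ Q) →-dec
  (R ≟ᶠ P ⊎-dec R ≟ᶠ Q ⊎-dec R ≟ᶠ third P Q) →-dec incident? R (lineOf P Q)} tt

incident-lineOf : ∀ P Q R → P ≢ Q → Incident R (lineOf P Q) → R ≡ P ⊎ R ≡ Q ⊎ R ≡ third P Q
incident-lineOf = toWitness {a? = all? λ P → all? λ Q → all? λ R → ¬? (P ≟ᶠ Q) →-dec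
  incident? R (lineOf P Q) →-dec (R ≟ᶠ P ⊎-dec R ≟ᶠ Q ⊎-dec R ≟ᶠ third P Q)} tt

third-distinct : ∀ P A → P ≢ A → A ≢ third P A
third-distinct = toWitness {a? = all? λ P → all? λ A → ¬? (P ≟ᶠ A) →-dec ¬? (A ≟ᶠ third P A)} tt

third-third : ∀ P A → P ≢ A → third A (third P A) ≡ P
third-third = toWitness {a? = all? λ P → all? λ A → ¬? (P ≟ᶠ A) →-dec third A (third P A) ≟ᶠ P} tt

lines-through : ∀ i D → Incident i D → T ((D == i) ∨ (D == (i ⊕ 6)) ∨ (D == (i ⊕ 4)))
lines-through = toWitness {a? = all? λ i → all? λ D → incident? i D →-dec Bool.T? ((D == i) ∨ (D == (i ⊕ 6)) ∨ (D == (i ⊕ 4)))} tt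

offLine-not-incident : ∀ D → ¬ Incident (D ⊕ 2) D
offLine-not-incident = toWitness {a? = all? λ D → ¬? (incident? (D ⊕ 2) D)} tt

incident-distinct : ∀ {P A D} → Incident P D → ¬ Incident A D → P ≢ A
incident-distinct P∈D A∉D refl = A∉D P∈D

-- Odd maps of the signed basis

Odd : (SU → SU) → Set
Odd f = ∀ x → f (negSU x) ≡ negSU (f x)

signed-image : ∀ {f} → Odd f → ∀ s P → f (s , P) ≡ (s *ₛ proj₁ (f (pos , P)) , π f P)
signed-image odd pos P = refl
signed-image odd neg P = odd (pos , P)

inverse-odd : ∀ {f f⁻¹} → Odd f → (∀ x → f⁻¹ (f x) ≡ x) → (∀ x → f (f⁻¹ x) ≡ x) → Odd f⁻¹
inverse-odd {f} {f⁻¹} odd left right x = begin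
  f⁻¹ (negSU x)              ≡⟨ cong (f⁻¹ ∘ negSU) (right x) ⟨
  f⁻¹ (negSU (f (f⁻¹ x)))    ≡⟨ cong f⁻¹ (odd (f⁻¹ x)) ⟨
  f⁻¹ (f (negSU (f⁻¹ x)))    ≡⟨ left (negSU (f⁻¹ x)) ⟩
  negSU (f⁻¹ x)              ∎
  where open ≡-Reasoning

-- Signed basis vectors of the octonions

module _ {c ℓ} (F : Field c ℓ) (ch : CharNot2 F) where
  open Field F hiding (zero)
    renaming (refl to ≈-refl; sym to ≈-sym; trans to ≈-trans; reflexive to ≈-reflexive)
  open Octonions F ch
  open import Algebra.Properties.Ring ring using (-0#≈0#; -‿involutive; -‿distribˡ-*; -‿distribʳ-*; -‿+-comm)
  open import Relation.Binary.Reasoning.Setoid setoid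

  Signed : Set
  Signed = Sign × Fin 8

  infixr 7 _⊙_
  _⊙_ : Signed → Signed → Signed
  (s , a) ⊙ (t , b) = (proj₁ (mulBasis a b) *ₛ (s *ₛ t) , proj₂ (mulBasis a b))

  -ˢ_ : Signed → Signed
  -ˢ (s , a) = (opposite s , a)

  ê : Point → Signed
  ê P = (pos , suc P)

  infix 4 _≟ˢ_
  _≟ˢ_ : (x y : Signed) → Dec (x ≡ y)
  _≟ˢ_ = ≡-dec Sign._≟_ _≟ᶠ_

  data EOpDiff : Set where
    e[_,_]−e[_,_] : Point → Point → Point → Point → EOpDiff

  Xterms : Point → Line → EOpDiff
  Xterms i D = if D == i then e[ i ⊕ 2 , i ⊕ 6 ]−e[ i ⊕ 4 , i ⊕ 5 ]
               else if D == (i ⊕ 6) then e[ i ⊕ 4 , i ⊕ 5 ]−e[ i ⊕ 1 , i ⊕ 3 ]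
               else e[ i ⊕ 1 , i ⊕ 3 ]−e[ i ⊕ 2 , i ⊕ 6 ]

  leading : EOpDiff → Signed → Signed
  leading e[ a , b ]−e[ _ , _ ] x = ê a ⊙ ê b ⊙ x

  SendsTo : EOpDiff → Signed → Signed → Set
  SendsTo e[ a , b ]−e[ c , d ] x y =
    (ê a ⊙ ê b ⊙ x ≡ y) × (ê b ⊙ ê a ⊙ x ≡ -ˢ y) × (ê c ⊙ ê d ⊙ x ≡ -ˢ y) × (ê d ⊙ ê c ⊙ x ≡ y)

  sendsTo? : ∀ p x y → Dec (SendsTo p x y)
  sendsTo? e[ a , b ]−e[ c , d ] x y =
    (ê a ⊙ ê b ⊙ x ≟ˢ y) ×-dec (ê b ⊙ ê a ⊙ x ≟ˢ -ˢ y) ×-dec (ê c ⊙ ê d ⊙ x ≟ˢ -ˢ y) ×-dec (ê d ⊙ ê c ⊙ x ≟ˢ y)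

  -- opaque: unfolding Xsign during conversion checking triggers expensive symbolic evaluation
  opaque
    Xsign : Point → Line → Point → Sign
    Xsign P D A = proj₁ (leading (Xterms P D) (pos , suc A))

  -- e_A · X_{P,D} e_A = Xweight P D A · e_P
  Xweight : Point → Line → Point → Sign
  Xweight P D A = Xsign P D A *ₛ ε A (third P A)

  opaque
    unfolding Xsign
    Xterms-sendsTo? : ∀ s → Dec (∀ P D A → Incident P D → ¬ Incident A D →
                                 SendsTo (Xterms P D) (s , suc A) (s *ₛ Xsign P D A , suc (third P A)))
    Xterms-sendsTo? s = all? λ P → all? λ D → all? λ A → incident? P D →-dec ¬? (incident? A D) →-dec
                          sendsTo? (Xterms P D) (s , suc A) (s *ₛ Xsign P D A , suc (third P A))

    Xterms-sendsTo : ∀ s P D A → Incident P D → ¬ Incident A D →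
                     SendsTo (Xterms P D) (s , suc A) (s *ₛ Xsign P D A , suc (third P A))
    Xterms-sendsTo pos = toWitness {a? = Xterms-sendsTo? pos} tt
    Xterms-sendsTo neg = toWitness {a? = Xterms-sendsTo? neg} tt

    Xweight-collinear : ∀ P Q A → P ≢ Q → ¬ Incident A (lineOf P Q) →
                        Xweight P (lineOf P Q) A *ₛ Xweight Q (lineOf P Q) A *ₛ Xweight (third P Q) (lineOf P Q) A ≡ pos
    Xweight-collinear = toWitness {a? = all? λ P → all? λ Q → all? λ A → ¬? (P ≟ᶠ Q) →-dec ¬? (incident? A (lineOf P Q)) →-dec
      (Xweight P (lineOf P Q) A *ₛ Xweight Q (lineOf P Q) A *ₛ Xweight (third P Q) (lineOf P Q) A Sign.≟ pos)} tt

  sgn-cong : ∀ s {x y} → x ≈ y → sgn s x ≈ sgn s y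
  sgn-cong pos eq = eq
  sgn-cong neg eq = -‿cong eq

  sgn-0# : ∀ s → sgn s 0# ≈ 0#
  sgn-0# pos = ≈-refl
  sgn-0# neg = -0#≈0#

  sgn-sgn : ∀ s t x → sgn s (sgn t x) ≈ sgn (s *ₛ t) x
  sgn-sgn pos t   x = ≈-refl
  sgn-sgn neg pos x = ≈-refl
  sgn-sgn neg neg x = -‿involutive x

  sgn-opposite : ∀ s x → sgn (opposite s) x ≈ - sgn s x
  sgn-opposite pos x = ≈-refl
  sgn-opposite neg x = ≈-sym (-‿involutive x)

  sgn-*ˡ : ∀ s x y → sgn s x * y ≈ sgn s (x * y)
  sgn-*ˡ pos x y = ≈-refl
  sgn-*ˡ neg x y = ≈-sym (-‿distribˡ-* x y)

  sgn-*ʳ : ∀ s x y → x * sgn s y ≈ sgn s (x * y)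
  sgn-*ʳ pos x y = ≈-refl
  sgn-*ʳ neg x y = ≈-sym (-‿distribʳ-* x y)

  sgn-* : ∀ s t x y → sgn s x * sgn t y ≈ sgn (s *ₛ t) (x * y)
  sgn-* s t x y = begin
    sgn s x * sgn t y      ≈⟨ sgn-*ˡ s x (sgn t y) ⟩
    sgn s (x * sgn t y)    ≈⟨ sgn-cong s (sgn-*ʳ t x y) ⟩
    sgn s (sgn t (x * y))  ≈⟨ sgn-sgn s t (x * y) ⟩
    sgn (s *ₛ t) (x * y)   ∎

  sgn1-* : ∀ s t → sgn s 1# * sgn t 1# ≈ sgn (s *ₛ t) 1#
  sgn1-* s t = ≈-trans (sgn-* s t 1# 1#) (sgn-cong (s *ₛ t) (*-identityˡ 1#))

  sgn-nonzero : ∀ s → ¬ (sgn s 1# ≈ 0#)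
  sgn-nonzero pos eq = 0≉1 (≈-sym eq)
  sgn-nonzero neg eq = 0≉1 (≈-sym (begin
    1#        ≈⟨ -‿involutive 1# ⟨
    - (- 1#)  ≈⟨ -‿cong eq ⟩
    - 0#      ≈⟨ -0#≈0# ⟩
    0#        ∎))

  1≉-1 : ¬ (1# ≈ - 1#)
  1≉-1 eq = ch (≈-trans (+-congʳ eq) (-‿inverseˡ 1#))

  sgn-injective : ∀ {s t} → sgn s 1# ≈ sgn t 1# → s ≡ t
  sgn-injective {pos} {pos} eq = refl
  sgn-injective {pos} {neg} eq = ⊥-elim (1≉-1 eq)
  sgn-injective {neg} {pos} eq = ⊥-elim (1≉-1 (≈-sym eq))
  sgn-injective {neg} {neg} eq = refl

  if-0# : ∀ b {x} → x ≈ 0# → (if b then x else 0#) ≈ 0#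
  if-0# true  eq = eq
  if-0# false eq = ≈-refl

  Σ'-cong : ∀ {n} {f g : Fin n → Carrier} → (∀ i → f i ≈ g i) → Σ' f ≈ Σ' g
  Σ'-cong {ℕ.zero}  eq = ≈-refl
  Σ'-cong {ℕ.suc n} eq = +-cong (eq zero) (Σ'-cong (eq ∘ suc))

  Σ'-0# : ∀ {n} {f : Fin n → Carrier} → (∀ i → f i ≈ 0#) → Σ' f ≈ 0#
  Σ'-0# {ℕ.zero}  eq = ≈-refl
  Σ'-0# {ℕ.suc n} eq = ≈-trans (+-cong (eq zero) (Σ'-0# (eq ∘ suc))) (+-identityˡ 0#)

  Σ'-select : ∀ {n} (f : Fin n → Carrier) a → (∀ i → i ≢ a → f i ≈ 0#) → Σ' f ≈ f a
  Σ'-select f zero    others = ≈-trans (+-congˡ (Σ'-0# λ i → others (suc i) λ ())) (+-identityʳ (f zero))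
  Σ'-select f (suc a) others =
    ≈-trans (+-congʳ (others zero λ ()))
    (≈-trans (+-identityˡ _) (Σ'-select (f ∘ suc) a λ i i≢a → others (suc i) (i≢a ∘ suc-injective)))

  ⟦_⟧ : Signed → V
  ⟦ s , a ⟧ k = sgn s (basis a k)

  ⟦⟧-diag : ∀ s a → ⟦ s , a ⟧ a ≈ sgn s 1#
  ⟦⟧-diag s a = sgn-cong s (≈-reflexive (cong (if_then 1# else 0#) (dec-true (a ≟ᶠ a) refl)))

  ⟦⟧-off : ∀ s {a k} → k ≢ a → ⟦ s , a ⟧ k ≈ 0#
  ⟦⟧-off s {a} {k} k≢a = ≈-trans (sgn-cong s (≈-reflexive (cong (if_then 1# else 0#) (dec-false (k ≟ᶠ a) k≢a)))) (sgn-0# s)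

  ⟦⟧-neg : ∀ x k → ⟦ -ˢ x ⟧ k ≈ - ⟦ x ⟧ k
  ⟦⟧-neg (s , a) k = sgn-opposite s (basis a k)

  ⟦⟧-injective : ∀ {x y} → ⟦ x ⟧ ≈V ⟦ y ⟧ → x ≡ y
  ⟦⟧-injective {s , a} {t , b} eq with a ≟ᶠ b
  ... | yes refl = cong (_, a) (sgn-injective (≈-trans (≈-sym (⟦⟧-diag s a)) (≈-trans (eq a) (⟦⟧-diag t a))))
  ... | no a≢b   = ⊥-elim (sgn-nonzero s (≈-trans (≈-sym (⟦⟧-diag s a)) (≈-trans (eq a) (⟦⟧-off t a≢b))))

  ⟦⟧-· : ∀ x y → (⟦ x ⟧ · ⟦ y ⟧) ≈V ⟦ x ⊙ y ⟧
  ⟦⟧-· (s , a) (t , b) k = begin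
    (⟦ s , a ⟧ · ⟦ t , b ⟧) k  ≈⟨ Σ'-select _ a (λ a′ a′≢a → Σ'-0# λ b′ → term-0# a′ b′
                                    (≈-trans (*-congʳ (⟦⟧-off s a′≢a)) (zeroˡ _))) ⟩
    Σ' (term a)                ≈⟨ Σ'-select _ b (λ b′ b′≢b → term-0# a b′
                                    (≈-trans (*-congˡ (⟦⟧-off t b′≢b)) (zeroʳ _))) ⟩
    term a b                   ≈⟨ term-diag (k ≟ᶠ proj₂ (mulBasis a b)) ⟩
    ⟦ (s , a) ⊙ (t , b) ⟧ k    ∎
    where
    term : Fin 8 → Fin 8 → Carrier
    term a′ b′ = if proj₂ (mulBasis a′ b′) == k
                 then sgn (proj₁ (mulBasis a′ b′)) (⟦ s , a ⟧ a′ * ⟦ t , b ⟧ b′) else 0#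
    term-0# : ∀ a′ b′ → ⟦ s , a ⟧ a′ * ⟦ t , b ⟧ b′ ≈ 0# → term a′ b′ ≈ 0#
    term-0# a′ b′ eq = if-0# (proj₂ (mulBasis a′ b′) == k)
      (≈-trans (sgn-cong (proj₁ (mulBasis a′ b′)) eq) (sgn-0# (proj₁ (mulBasis a′ b′))))
    m : Sign
    m = proj₁ (mulBasis a b)
    value : Carrier
    value = sgn m (⟦ s , a ⟧ a * ⟦ t , b ⟧ b)
    term-diag : Dec (k ≡ proj₂ (mulBasis a b)) → term a b ≈ ⟦ (s , a) ⊙ (t , b) ⟧ k
    term-diag (yes refl) = begin
      term a b                                ≈⟨ ≈-reflexive (cong (if_then value else 0#) (dec-true (k ≟ᶠ k) refl)) ⟩
      sgn m (⟦ s , a ⟧ a * ⟦ t , b ⟧ b)       ≈⟨ sgn-cong m (*-cong (⟦⟧-diag s a) (⟦⟧-diag t b)) ⟩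
      sgn m (sgn s 1# * sgn t 1#)             ≈⟨ sgn-cong m (sgn1-* s t) ⟩
      sgn m (sgn (s *ₛ t) 1#)                 ≈⟨ sgn-sgn m (s *ₛ t) 1# ⟩
      sgn (m *ₛ (s *ₛ t)) 1#                  ≈⟨ ⟦⟧-diag (m *ₛ (s *ₛ t)) k ⟨
      ⟦ (s , a) ⊙ (t , b) ⟧ k                 ∎
    term-diag (no k≢i) = ≈-trans (≈-reflexive (cong (if_then value else 0#) (dec-false (proj₂ (mulBasis a b) ≟ᶠ k) (k≢i ∘ sym))))
                                 (≈-sym (⟦⟧-off (m *ₛ (s *ₛ t)) k≢i))

  ·-congʳ : ∀ u {v v′} → v ≈V v′ → (u · v) ≈V (u · v′)
  ·-congʳ u eq k = Σ'-cong λ a → Σ'-cong λ b → if-cong (proj₂ (mulBasis a b) == k)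
                     (sgn-cong (proj₁ (mulBasis a b)) (*-congˡ {u a} (eq b)))
    where
    if-cong : ∀ b {x y} → x ≈ y → (if b then x else 0#) ≈ (if b then y else 0#)
    if-cong true  eq = eq
    if-cong false eq = ≈-refl

  L-⟦⟧ : ∀ P x → L (eP P) ⟦ x ⟧ ≈V ⟦ ê P ⊙ x ⟧
  L-⟦⟧ P x = ⟦⟧-· (ê P) x

  LL-⟦⟧ : ∀ P Q x → (L (eP P) ∘ₒ L (eP Q)) ⟦ x ⟧ ≈V ⟦ ê P ⊙ ê Q ⊙ x ⟧
  LL-⟦⟧ P Q x k = ≈-trans (·-congʳ (eP P) (L-⟦⟧ Q x) k) (L-⟦⟧ P (ê Q ⊙ x) k)

  eOp-⟦⟧ : ∀ a b x k → eOp a b ⟦ x ⟧ k ≈ quarter * (⟦ ê a ⊙ ê b ⊙ x ⟧ k - ⟦ ê b ⊙ ê a ⊙ x ⟧ k)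
  eOp-⟦⟧ a b x k = *-congˡ (+-cong (LL-⟦⟧ a b x k) (-‿cong (LL-⟦⟧ b a x k)))

  eOp-cong : ∀ a b {u u′} → u ≈V u′ → eOp a b u ≈V eOp a b u′
  eOp-cong a b eq k = *-congˡ (+-cong (·-congʳ (eP a) (·-congʳ (eP b) eq) k)
                                      (-‿cong (·-congʳ (eP b) (·-congʳ (eP a) eq) k)))

  ⟦_⟧ₑ : EOpDiff → Op
  ⟦ e[ a , b ]−e[ c , d ] ⟧ₑ = eOp a b -ₒ eOp c d

  ⟦⟧ₑ-cong : ∀ p {u u′} → u ≈V u′ → ⟦ p ⟧ₑ u ≈V ⟦ p ⟧ₑ u′
  ⟦⟧ₑ-cong e[ a , b ]−e[ c , d ] eq k = +-cong (eOp-cong a b eq k) (-‿cong (eOp-cong c d eq k))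

  X-incident : ∀ {i D} → Incident i D → X i D ≡ ⟦ Xterms i D ⟧ₑ
  X-incident {i} {D} i∈D = select (D == i) (D == (i ⊕ 6)) (D == (i ⊕ 4)) (lines-through i D i∈D)
    where
    select : ∀ b₁ b₂ b₃ → T (b₁ ∨ b₂ ∨ b₃) →
      (if b₁ then eOp (i ⊕ 2) (i ⊕ 6) -ₒ eOp (i ⊕ 4) (i ⊕ 5)
       else if b₂ then eOp (i ⊕ 4) (i ⊕ 5) -ₒ eOp (i ⊕ 1) (i ⊕ 3)
       else if b₃ then eOp (i ⊕ 1) (i ⊕ 3) -ₒ eOp (i ⊕ 2) (i ⊕ 6)
       else zeroOp)
      ≡ ⟦ if b₁ then e[ i ⊕ 2 , i ⊕ 6 ]−e[ i ⊕ 4 , i ⊕ 5 ]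
          else if b₂ then e[ i ⊕ 4 , i ⊕ 5 ]−e[ i ⊕ 1 , i ⊕ 3 ]
          else e[ i ⊕ 1 , i ⊕ 3 ]−e[ i ⊕ 2 , i ⊕ 6 ] ⟧ₑ
    select true  _     _    _ = refl
    select false true  _    _ = refl
    select false false true _ = refl

  X-cong : ∀ {i D u u′} → Incident i D → u ≈V u′ → X i D u ≈V X i D u′
  X-cong {i} {D} {u} {u′} i∈D eq =
    subst (λ O → O u ≈V O u′) (sym (X-incident {i} {D} i∈D)) (⟦⟧ₑ-cong (Xterms i D) eq)

  half+half : half + half ≈ 1#
  half+half = begin
    half + half             ≈⟨ +-cong (*-identityˡ half) (*-identityˡ half) ⟨
    1# * half + 1# * half   ≈⟨ distribʳ half 1# 1# ⟨
    (1# + 1#) * half        ≈⟨ proj₂ (inverse (1# + 1#) ch) ⟩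
    1#                      ∎

  quarter-identity : ∀ z → quarter * (z - - z) - quarter * (- z - z) ≈ z
  quarter-identity z = begin
    quarter * (z - - z) - quarter * (- z - z)        ≈⟨ +-cong (*-congˡ (+-congˡ (-‿involutive z)))
                                                                (-‿cong (*-congˡ (-‿+-comm z z))) ⟩
    quarter * (z + z) - quarter * (- (z + z))        ≈⟨ +-congˡ (-‿cong (-‿distribʳ-* quarter (z + z))) ⟨
    quarter * (z + z) - - (quarter * (z + z))        ≈⟨ +-congˡ (-‿involutive _) ⟩
    quarter * (z + z) + quarter * (z + z)            ≈⟨ distribʳ (z + z) quarter quarter ⟨
    (half * half + half * half) * (z + z)            ≈⟨ *-congʳ (distribʳ half half half) ⟨
    (half + half) * half * (z + z)                   ≈⟨ *-congʳ (≈-trans (*-congʳ half+half) (*-identityˡ half)) ⟩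
    half * (z + z)                                   ≈⟨ distribˡ half z z ⟩
    half * z + half * z                              ≈⟨ distribʳ z half half ⟨
    (half + half) * z                                ≈⟨ ≈-trans (*-congʳ half+half) (*-identityˡ z) ⟩
    z                                                ∎

  sendsTo-⟦⟧ : ∀ p {x y} → SendsTo p x y → ⟦ p ⟧ₑ ⟦ x ⟧ ≈V ⟦ y ⟧
  sendsTo-⟦⟧ e[ a , b ]−e[ c , d ] {x} {y} (ab , ba , cd , dc) k = begin
    eOp a b ⟦ x ⟧ k - eOp c d ⟦ x ⟧ k
      ≈⟨ +-cong (eOp-⟦⟧ a b x k) (-‿cong (eOp-⟦⟧ c d x k)) ⟩
    quarter * (⟦ ê a ⊙ ê b ⊙ x ⟧ k - ⟦ ê b ⊙ ê a ⊙ x ⟧ k) - quarter * (⟦ ê c ⊙ ê d ⊙ x ⟧ k - ⟦ ê d ⊙ ê c ⊙ x ⟧ k)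
      ≈⟨ ≈-reflexive (cong₂ _-_ (cong₂ (λ u v → quarter * (⟦ u ⟧ k - ⟦ v ⟧ k)) ab ba)
                                (cong₂ (λ u v → quarter * (⟦ u ⟧ k - ⟦ v ⟧ k)) cd dc)) ⟩
    quarter * (⟦ y ⟧ k - ⟦ -ˢ y ⟧ k) - quarter * (⟦ -ˢ y ⟧ k - ⟦ y ⟧ k)
      ≈⟨ +-cong (*-congˡ (+-congˡ (-‿cong (⟦⟧-neg y k)))) (-‿cong (*-congˡ (+-congʳ (⟦⟧-neg y k)))) ⟩
    quarter * (⟦ y ⟧ k - - ⟦ y ⟧ k) - quarter * (- ⟦ y ⟧ k - ⟦ y ⟧ k)
      ≈⟨ quarter-identity (⟦ y ⟧ k) ⟩
    ⟦ y ⟧ k ∎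

  X-on-basis : ∀ s {P D A} → Incident P D → ¬ Incident A D →
               X P D ⟦ s , suc A ⟧ ≈V ⟦ s *ₛ Xsign P D A , suc (third P A) ⟧
  X-on-basis s {P} {D} {A} P∈D A∉D =
    subst (λ O → O ⟦ s , suc A ⟧ ≈V ⟦ s *ₛ Xsign P D A , suc (third P A) ⟧) (sym (X-incident {P} {D} P∈D))
          (sendsTo-⟦⟧ (Xterms P D) (Xterms-sendsTo s P D A P∈D A∉D))

  ⊙-distinct : ∀ {a b} s t → a ≢ b → (s , suc a) ⊙ (t , suc b) ≡ (ε a b *ₛ (s *ₛ t) , suc (third a b))
  ⊙-distinct {a} {b} s t a≢b = cong (λ m → (proj₁ m *ₛ (s *ₛ t) , proj₂ m))
    (cong (if_then (neg , zero) else (ε a b , suc (third a b))) (dec-false (a ≟ᶠ b) a≢b))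

  prodOn-Xweight : ∀ {D A} → ¬ Incident A D → prodOn (λ P → Xweight P D A) D ≡ pos
  prodOn-Xweight {D} {A} A∉D =
    subst₂ (λ L R → Xweight (pt D zero) L A *ₛ Xweight (pt D (suc zero)) L A *ₛ Xweight R L A ≡ pos)
           (pt-lineOf D) (pt-third D)
           (Xweight-collinear (pt D zero) (pt D (suc zero)) A (pt-distinct D) (subst (¬_ ∘ Incident A) (sym (pt-lineOf D)) A∉D))

  ext-ι : ∀ {f} → Odd f → ∀ x → ext f (ι x) ≈V ι (f x)
  ext-ι {f} odd (s , P) k = begin
    ext f ⟦ s , suc P ⟧ k
      ≈⟨ +-cong (if-0# (k == zero) (⟦⟧-off s {suc P} {zero} λ ()))
                (Σ'-select _ P λ E E≢P → ≈-trans (*-congʳ {ι (f (pos , E)) k} (⟦⟧-off s (E≢P ∘ suc-injective)))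
                                                 (zeroˡ _)) ⟩
    0# + ⟦ s , suc P ⟧ (suc P) * ι (f (pos , P)) k
      ≈⟨ ≈-trans (+-identityˡ _) (*-congʳ (⟦⟧-diag s (suc P))) ⟩
    sgn s 1# * ι (f (pos , P)) k
      ≈⟨ ≈-trans (sgn-*ˡ s 1# _) (sgn-cong s (*-identityˡ _)) ⟩
    sgn s (sgn (proj₁ (f (pos , P))) (basis (suc (π f P)) k))
      ≈⟨ sgn-sgn s _ _ ⟩
    ι (s *ₛ proj₁ (f (pos , P)) , π f P) k
      ≡⟨ cong (λ y → ι y k) (signed-image odd s P) ⟨
    ι (f (s , P)) k ∎

  module Automorphism {h hinv : SU → SU} (isA : IsAut h hinv) where
    open IsAut isA

    σ : Point → Sign
    σ P = proj₁ (h (pos , P))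

    h-signed : ∀ s P → h (s , P) ≡ (s *ₛ σ P , π h P)
    h-signed = signed-image odd

    ι-h : ∀ P → ι (h (pos , P)) ≡ ⟦ σ P , suc (π h P) ⟧
    ι-h P = refl

    h-injective : ∀ {x y} → h x ≡ h y → x ≡ y
    h-injective {x} {y} hx≡hy = trans (sym (left-inv x)) (trans (cong hinv hx≡hy) (left-inv y))

    π-injective : ∀ {i j} → π h i ≡ π h j → i ≡ j
    π-injective {i} {j} πi≡πj = cong proj₂ (h-injective (trans
      (cong₂ _,_ (sym (//-rightDividesʳ (σ j) (σ i))) πi≡πj) (sym (h-signed (σ i *ₛ σ j) j))))

    hinv-odd : Odd hinv
    hinv-odd = inverse-odd odd left-inv right-inv

    ext-at-image : ∀ w B → ext h w (suc (π h B)) ≈ w (suc B) * sgn (σ B) 1#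
    ext-at-image w B = ≈-trans (+-identityˡ _)
      (≈-trans (Σ'-select _ B λ E E≢B → ≈-trans (*-congˡ {w (suc E)} (⟦⟧-off (σ E) (E≢B ∘ π-injective ∘ sym ∘ suc-injective)))
                                                (zeroʳ _))
               (*-congˡ (⟦⟧-diag (σ B) (suc (π h B)))))

    multiplicative : ∀ {P Q} → P ≢ Q →
      (ε P Q *ₛ σ (third P Q) , suc (π h (third P Q))) ≡ (ε (π h P) (π h Q) *ₛ (σ P *ₛ σ Q) , suc (third (π h P) (π h Q)))
    multiplicative {P} {Q} P≢Q = ⟦⟧-injective
      {ε P Q *ₛ σ (third P Q) , suc (π h (third P Q))} {ε (π h P) (π h Q) *ₛ (σ P *ₛ σ Q) , suc (third (π h P) (π h Q))}
      λ k → begin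
      ι (ε P Q *ₛ σ (third P Q) , π h (third P Q)) k        ≡⟨ cong (λ y → ι y k) (h-signed (ε P Q) (third P Q)) ⟨
      ι (h (mulSU P Q)) k                                   ≈⟨ mult P Q P≢Q k ⟩
      (ι (h (pos , P)) · ι (h (pos , Q))) k                 ≡⟨ cong₂ (λ u v → (u · v) k) (ι-h P) (ι-h Q) ⟩
      (⟦ σ P , suc (π h P) ⟧ · ⟦ σ Q , suc (π h Q) ⟧) k    ≈⟨ ⟦⟧-· (σ P , suc (π h P)) (σ Q , suc (π h Q)) k ⟩
      ⟦ (σ P , suc (π h P)) ⊙ (σ Q , suc (π h Q)) ⟧ k      ≡⟨ cong (λ y → ⟦ y ⟧ k) (⊙-distinct (σ P) (σ Q) (P≢Q ∘ π-injective)) ⟩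
      ⟦ ε (π h P) (π h Q) *ₛ (σ P *ₛ σ Q) , suc (third (π h P) (π h Q)) ⟧ k ∎

    π-third : ∀ {P Q} → P ≢ Q → π h (third P Q) ≡ third (π h P) (π h Q)
    π-third P≢Q = suc-injective (cong proj₂ (multiplicative P≢Q))

    σ-third : ∀ {P Q} → P ≢ Q → σ P *ₛ σ Q *ₛ σ (third P Q) ≡ ε P Q *ₛ ε (π h P) (π h Q)
    σ-third {P} {Q} P≢Q =
      *ₛ-transpose {ε P Q} {ε (π h P) (π h Q)} {σ P *ₛ σ Q} {σ (third P Q)} (cong proj₁ (multiplicative P≢Q))

    σ-line : ∀ D → prodOn σ D ≡ δ* (π h) D
    σ-line D = trans (cong (λ R → σ (pt D zero) *ₛ σ (pt D (suc zero)) *ₛ σ R) (sym (pt-third D)))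
                     (σ-third (pt-distinct D))

    π-pt-distinct : ∀ D → π h (pt D zero) ≢ π h (pt D (suc zero))
    π-pt-distinct D = pt-distinct D ∘ π-injective

    π-pt₂ : ∀ D → π h (pt D (suc (suc zero))) ≡ third (π h (pt D zero)) (π h (pt D (suc zero)))
    π-pt₂ D = trans (cong (π h) (sym (pt-third D))) (π-third (pt-distinct D))

    π-incident : ∀ {P D} → Incident P D → Incident (π h P) (imgLine (π h) D)
    π-incident {P} {D} P∈D with incident⇒pt P D P∈D
    ... | zero           , refl = lineOf-incident _ _ (π h P) (π-pt-distinct D) (inj₁ refl)
    ... | suc zero       , refl = lineOf-incident _ _ (π h P) (π-pt-distinct D) (inj₂ (inj₁ refl))
    ... | suc (suc zero) , refl = lineOf-incident _ _ (π h P) (π-pt-distinct D) (inj₂ (inj₂ (π-pt₂ D)))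

    π-nonincident : ∀ {A D} → ¬ Incident A D → ¬ Incident (π h A) (imgLine (π h) D)
    π-nonincident {A} {D} A∉D πA∈πD = A∉D (on-line (incident-lineOf (π h (pt D zero)) (π h (pt D (suc zero))) (π h A)
                                                     (π-pt-distinct D) πA∈πD))
      where
      on-line : π h A ≡ π h (pt D zero) ⊎ π h A ≡ π h (pt D (suc zero)) ⊎ π h A ≡ third (π h (pt D zero)) (π h (pt D (suc zero)))
              → Incident A D
      on-line (inj₁ πA≡πP₀)        = subst (λ P → Incident P D) (sym (π-injective πA≡πP₀)) (pt-incident D zero)
      on-line (inj₂ (inj₁ πA≡πP₁)) = subst (λ P → Incident P D) (sym (π-injective πA≡πP₁)) (pt-incident D (suc zero))
      on-line (inj₂ (inj₂ πA≡πP₂)) = subst (λ P → Incident P D) (sym (π-injective (trans πA≡πP₂ (sym (π-pt₂ D)))))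
                                           (pt-incident D (suc (suc zero)))

    prodOn-Xweight-image : ∀ {D A} → ¬ Incident A D → prodOn (λ P → Xweight (π h P) (imgLine (π h) D) (π h A)) D ≡ pos
    prodOn-Xweight-image {D} {A} A∉D =
      subst (λ R → Xweight (π h (pt D zero)) (imgLine (π h) D) (π h A) *ₛ Xweight (π h (pt D (suc zero))) (imgLine (π h) D) (π h A)
                     *ₛ Xweight R (imgLine (π h) D) (π h A) ≡ pos)
            (sym (π-pt₂ D))
            (Xweight-collinear (π h (pt D zero)) (π h (pt D (suc zero))) (π h A) (π-pt-distinct D) (π-nonincident A∉D))

    -- the two sides of ĥ X_{P,D} ĥ⁻¹ = δ(P) X_{gP,gD}, applied to ĥ e_A and read off at e_{g(P+A)}
    δ-identity-lhs : ∀ {P D A} → Incident P D → ¬ Incident A D →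
      ext h (X P D (ext hinv (ι (h (pos , A))))) (suc (π h (third P A))) ≈ sgn (Xsign P D A *ₛ σ (third P A)) 1#
    δ-identity-lhs {P} {D} {A} P∈D A∉D = begin
      ext h (X P D (ext hinv (ι (h (pos , A))))) (suc (π h (third P A)))
        ≈⟨ ext-at-image (X P D (ext hinv (ι (h (pos , A))))) (third P A) ⟩
      X P D (ext hinv (ι (h (pos , A)))) (suc (third P A)) * sgn (σ (third P A)) 1#
        ≈⟨ *-congʳ (X-cong {P} {D} P∈D e-A (suc (third P A))) ⟩
      X P D ⟦ pos , suc A ⟧ (suc (third P A)) * sgn (σ (third P A)) 1#
        ≈⟨ *-congʳ (≈-trans (X-on-basis pos {P} {D} {A} P∈D A∉D (suc (third P A))) (⟦⟧-diag (Xsign P D A) (suc (third P A)))) ⟩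
      sgn (Xsign P D A) 1# * sgn (σ (third P A)) 1#
        ≈⟨ sgn1-* (Xsign P D A) (σ (third P A)) ⟩
      sgn (Xsign P D A *ₛ σ (third P A)) 1# ∎
      where
      e-A : ext hinv (ι (h (pos , A))) ≈V ⟦ pos , suc A ⟧
      e-A k = ≈-trans (ext-ι hinv-odd (h (pos , A)) k) (≈-reflexive (cong (λ y → ι y k) (left-inv (pos , A))))

    δ-identity-rhs : ∀ {P D A} → Incident P D → ¬ Incident A D →
      X (π h P) (imgLine (π h) D) (ι (h (pos , A))) (suc (π h (third P A)))
        ≈ sgn (σ A *ₛ Xsign (π h P) (imgLine (π h) D) (π h A)) 1#
    δ-identity-rhs {P} {D} {A} P∈D A∉D = begin
      X (π h P) (imgLine (π h) D) (ι (h (pos , A))) (suc (π h (third P A)))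
        ≡⟨ cong (λ u → X (π h P) (imgLine (π h) D) u (suc (π h (third P A)))) (ι-h A) ⟩
      X (π h P) (imgLine (π h) D) ⟦ σ A , suc (π h A) ⟧ (suc (π h (third P A)))
        ≈⟨ X-on-basis (σ A) {π h P} {imgLine (π h) D} {π h A} (π-incident P∈D) (π-nonincident A∉D) (suc (π h (third P A))) ⟩
      ⟦ σ A *ₛ f′ , suc (third (π h P) (π h A)) ⟧ (suc (π h (third P A)))
        ≡⟨ cong (λ R → ⟦ σ A *ₛ f′ , suc R ⟧ (suc (π h (third P A)))) (π-third (incident-distinct P∈D A∉D)) ⟨
      ⟦ σ A *ₛ f′ , suc (π h (third P A)) ⟧ (suc (π h (third P A)))
        ≈⟨ ⟦⟧-diag (σ A *ₛ f′) (suc (π h (third P A))) ⟩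
      sgn (σ A *ₛ f′) 1# ∎
      where f′ = Xsign (π h P) (imgLine (π h) D) (π h A)

    δ-factorisation : ∀ {δ} → IsDelta h hinv δ → ∀ {P D A} → Incident P D → ¬ Incident A D →
                      δ P ≡ σ P *ₛ (Xweight P D A *ₛ Xweight (π h P) (imgLine (π h) D) (π h A))
    δ-factorisation {δ} isD {P} {D} {A} P∈D A∉D =
      trans (solve-for-δ (Xsign P D A) (Xsign (π h P) (imgLine (π h) D) (π h A)) (σ A) (σ (third P A)) (σ P)
                         (ε A (third P A)) (ε (π h A) (π h (third P A))) (δ P) conjugation line-AB)
            (cong (λ R → σ P *ₛ (Xweight P D A *ₛ (Xsign (π h P) (imgLine (π h) D) (π h A) *ₛ ε (π h A) R))) (π-third P≢A))
      where
      P≢A = incident-distinct P∈D A∉D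
      conjugation : Xsign P D A *ₛ σ (third P A) ≡ δ P *ₛ (σ A *ₛ Xsign (π h P) (imgLine (π h) D) (π h A))
      conjugation = sgn-injective (≈-trans (≈-sym (δ-identity-lhs P∈D A∉D))
        (≈-trans (isD P D P∈D (ι (h (pos , A))) (suc (π h (third P A))))
        (≈-trans (sgn-cong (δ P) (δ-identity-rhs P∈D A∉D))
                 (sgn-sgn (δ P) (σ A *ₛ Xsign (π h P) (imgLine (π h) D) (π h A)) 1#))))
      line-AB : σ A *ₛ σ (third P A) *ₛ σ P ≡ ε A (third P A) *ₛ ε (π h A) (π h (third P A))
      line-AB = trans (cong (λ R → σ A *ₛ σ (third P A) *ₛ σ R) (sym (third-third P A P≢A)))
                      (σ-third (third-distinct P A P≢A))

proposition3p12 : ∀ {c ℓ : Level} (F : Field c ℓ) (ch : CharNot2 F)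
    (h hinv : SU → SU) → Octonions.IsAut F ch h hinv →
    (δ : Point → Sign) → Octonions.IsDelta F ch h hinv δ →
    ∀ (D : Line) → δ* (π h) D ≡ prodOn δ D
proposition3p12 F ch h hinv isA δ isD D = sym (begin
  prodOn δ D                                     ≡⟨ prodOn-cong {δ} {λ P → σ P *ₛ (w P *ₛ w′ P)} D
                                                        (λ i → δ-factorisation {δ} isD {pt D i} {D} {A} (pt-incident D i) A∉D) ⟩
  prodOn (λ P → σ P *ₛ (w P *ₛ w′ P)) D         ≡⟨ prodOn-* σ (λ P → w P *ₛ w′ P) D ⟩
  prodOn σ D *ₛ prodOn (λ P → w P *ₛ w′ P) D    ≡⟨ cong (prodOn σ D *ₛ_) (prodOn-* w w′ D) ⟩
  prodOn σ D *ₛ (prodOn w D *ₛ prodOn w′ D)     ≡⟨ cong₂ _*ₛ_ (σ-line D) (cong₂ _*ₛ_ (prodOn-Xweight F ch A∉D) (prodOn-Xweight-image A∉D)) ⟩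
  δ* (π h) D *ₛ pos                              ≡⟨ Sign.*-identityʳ (δ* (π h) D) ⟩
  δ* (π h) D                                     ∎)
  where
  open Automorphism F ch isA
  open ≡-Reasoning
  A : Point
  A = D ⊕ 2
  A∉D : ¬ Incident A D
  A∉D = offLine-not-incident D
  w w′ : Point → Sign
  w P = Xweight F ch P D A
  w′ P = Xweight F ch (π h P) (imgLine (π h) D) (π h A)
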